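{- Suppose $(\mathsf P,\mathsf{Opens})$ is a semitopology. Then the following are equivalent: \begin{enumerate} \item $(\mathsf P,\mathsf{Opens})$ is regular. \item $\mathsf P$ partitions into topen sets: there exists some set of topen sets $\mathcal T$ such that $T\cap T'=\varnothing$ for every distinct $T,T'\in\mathcal T$ and $\mathsf P=\bigcup\mathcal T$. \item Every $X\subseteq\mathsf P$ has a cover of topen sets: there exists some set of topen sets $\mathcal T$ such that $X\subseteq\bigcup\mathcal T$. \end{enumerate}
   Context: A semitopology is a pair $(\mathsf P,\mathsf{Opens})$ with $\mathsf{Opens}\subseteq\mathcal P(\mathsf P)$ containing $\varnothing$ and $\mathsf P$ and closed under arbitrary unions. For sets $X,Y$ write $X\between Y$ when $X\cap Y\neq\varnothing$. A set $T$ is topen when it is nonempty, open and transitive (for all open $O,O'$, $O\between T\between O'$ implies $O\between O'$); $\mathsf{Topen}$ is the set of topens. Points $p,p'$ are intertwined when every open neighbourhood of $p$ intersects every open neighbourhood of $p'$; $p_{\between}$ denotes the set of points intertwined with $p$. $\mathrm{interior}(X)$ is the union of open sets contained in $X$. The community of $p$ is $K(p)=\mathrm{interior}(p_{\between})$; $p$ is regular when $p\in K(p)\in\mathsf{Topen}$, and the semitopology is regular when every point is regular. -}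

module Defs where

open import Data.Product using (Σ; ∃; _×_; _,_)
open import Data.Empty using (⊥)
open import Data.Unit using (⊤)
open import Relation.Nullary using (¬_)

Subset : Set → Set₁
Subset A = A → Set

module _ {A : Set} where
  _⊆_ : Subset A → Subset A → Set
  X ⊆ Y = ∀ x → X x → Y x

  _≐_ : Subset A → Subset A → Set
  X ≐ Y = (X ⊆ Y) × (Y ⊆ X)

  _≬_ : Subset A → Subset A → Set
  X ≬ Y = ∃ λ x → X x × Y x

  emptySet : Subset A
  emptySet _ = ⊥

  fullSet : Subset A
  fullSet _ = ⊤

  ⋃ᶠ : {J : Set} → (J → Subset A) → Subset A
  ⋃ᶠ {J} F x = ∃ λ j → F j x

-- The set Opens ⊆ 𝒫(P) is presented as the image of a
-- family  open : Idx → Subset Carrier  (every set of subsets is such an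
-- image, indexed by itself).
record Semitopology : Set₁ where
  field
    Carrier  : Set
    Idx      : Set
    open-set : Idx → Subset Carrier
    ∅-open   : ∃ λ i → open-set i ≐ emptySet
    P-open   : ∃ λ i → open-set i ≐ fullSet
    ⋃-open   : (J : Set) (f : J → Idx) → ∃ λ i → open-set i ≐ ⋃ᶠ (λ j → open-set (f j))

module _ (S : Semitopology) where
  open Semitopology S

  IsOpen : Subset Carrier → Set
  IsOpen X = ∃ λ i → open-set i ≐ X

  Transitive : Subset Carrier → Set
  Transitive T = ∀ i j → open-set i ≬ T → T ≬ open-set j → open-set i ≬ open-set j

  Topen : Subset Carrier → Set
  Topen T = (∃ λ x → T x) × IsOpen T × Transitive T

  Intertwined : Carrier → Carrier → Set
  Intertwined p p' = ∀ i j → open-set i p → open-set j p' → open-set i ≬ open-set j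

  intertwinedSet : Carrier → Subset Carrier
  intertwinedSet p = Intertwined p

  interior : Subset Carrier → Subset Carrier
  interior X x = ∃ λ i → (open-set i ⊆ X) × open-set i x

  K : Carrier → Subset Carrier
  K p = interior (intertwinedSet p)

  RegularPoint : Carrier → Set
  RegularPoint p = K p p × Topen (K p)

  Regular : Set
  Regular = ∀ p → RegularPoint p

  PartitionsIntoTopens : Set₁
  PartitionsIntoTopens =
    Σ (Subset Carrier → Set) λ 𝒯 →
      (∀ T → 𝒯 T → Topen T)
      × (∀ T T' → 𝒯 T → 𝒯 T' → ¬ (T ≐ T') → ¬ (T ≬ T'))
      × (∀ x → ∃ λ T → 𝒯 T × T x)

  EveryCoveredByTopens : Set₁
  EveryCoveredByTopens =
    (X : Subset Carrier) →
      Σ (Subset Carrier → Set) λ 𝒯 →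
        (∀ T → 𝒯 T → Topen T) × (∀ x → X x → ∃ λ T → 𝒯 T × T x)

-- A topen T is a set of pairwise intertwined points, and it is open, so T ⊆ K(x) for every
-- x ∈ T; moreover every open set meeting K(x) meets T, so K(x) inherits transitivity from T.
-- Hence a point is regular as soon as it lies in some topen, which gives (2) ⇒ (1) and
-- (3) ⇒ (1) (cover P itself).  Conversely, in a regular semitopology the communities are
-- topens, and two communities that meet are equal, so they partition P and cover every X.
module Submission where

open import Defs
open import Data.Product using (Σ; ∃; _×_; _,_; proj₁; proj₂)
open import Data.Unit using (tt)
open import Relation.Nullary using (¬_)

module _ (S : Semitopology) where
  open Semitopology S

  Topen-resp-≐ : ∀ {T U} → T ≐ U → Topen S T → Topen S U
  Topen-resp-≐ (T⊆U , U⊆T) ((x , Tx) , (t , t⊆T , T⊆t) , transT) =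
    (x , T⊆U x Tx) ,
    (t , (λ y ty → T⊆U y (t⊆T y ty)) , (λ y Uy → T⊆t y (U⊆T y Uy))) ,
    (λ i j (z , iz , Uz) (w , Uw , jw) → transT i j (z , iz , U⊆T z Uz) (w , U⊆T w Uw , jw))

  topen⇒intertwined : ∀ {T x y} → Topen S T → T x → T y → Intertwined S x y
  topen⇒intertwined (_ , _ , transT) Tx Ty i j ix jy = transT i j (_ , ix , Tx) (_ , Ty , jy)

  topen⊆K : ∀ {T x} → Topen S T → T x → T ⊆ K S x
  topen⊆K topenT@(_ , (t , t⊆T , T⊆t) , _) Tx y Ty =
    t , (λ z tz → topen⇒intertwined topenT Tx (t⊆T z tz)) , T⊆t y Ty

  K⊆intertwinedSet : ∀ x → K S x ⊆ intertwinedSet S x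
  K⊆intertwinedSet x y (k , k⊆ , ky) = k⊆ y ky

  K-open : ∀ x → IsOpen S (K S x)
  K-open x with ⋃-open (Σ Idx λ i → open-set i ⊆ intertwinedSet S x) proj₁
  ... | k , k⊆⋃ , ⋃⊆k =
    k , (λ y ky → let ((i , i⊆) , iy) = k⊆⋃ y ky in i , i⊆ , iy)
      , (λ y (i , i⊆ , iy) → ⋃⊆k y ((i , i⊆) , iy))

  Transitive-if-meets-reflect : ∀ {T U} → Transitive S T →
    (∀ i → open-set i ≬ U → open-set i ≬ T) → Transitive S U
  Transitive-if-meets-reflect transT reflect i j iU Uj
    with reflect j (let (z , Uz , jz) = Uj in z , jz , Uz)
  ... | z , jz , Tz = transT i j (reflect i iU) (z , Tz , jz)

  opens-meeting-K-meet-topen : ∀ {T x} → Topen S T → T x →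
    ∀ i → open-set i ≬ K S x → open-set i ≬ T
  opens-meeting-K-meet-topen (_ , (t , t⊆T , T⊆t) , _) Tx i (q , iq , Kq)
    with K⊆intertwinedSet _ q Kq t i (T⊆t _ Tx) iq
  ... | z , tz , iz = z , iz , t⊆T z tz

  topen-member-regular : ∀ {T x} → Topen S T → T x → RegularPoint S x
  topen-member-regular topenT Tx =
    Kxx , (_ , Kxx) , K-open _ ,
    Transitive-if-meets-reflect (proj₂ (proj₂ topenT)) (opens-meeting-K-meet-topen topenT Tx)
    where
    Kxx = topen⊆K topenT Tx _ Tx

  regular-if-topens-cover : (∀ x → ∃ λ T → Topen S T × T x) → Regular S
  regular-if-topens-cover cover x = let (T , topenT , Tx) = cover x in topen-member-regular topenT Tx

  module _ (regular : Regular S) where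

    K-topen : ∀ x → Topen S (K S x)
    K-topen x = proj₂ (regular x)

    K-self : ∀ x → K S x x
    K-self x = proj₁ (regular x)

    K-≐-member : ∀ {p x} → K S p x → K S p ≐ K S x
    K-≐-member {p} {x} Kpx = Kp⊆Kx , topen⊆K (K-topen x) (Kp⊆Kx p (K-self p))
      where
      Kp⊆Kx = topen⊆K (K-topen p) Kpx

    K-≐-if-≬ : ∀ {p q} → K S p ≬ K S q → K S p ≐ K S q
    K-≐-if-≬ (x , Kpx , Kqx) with K-≐-member Kpx | K-≐-member Kqx
    ... | (Kp⊆Kx , Kx⊆Kp) | (Kq⊆Kx , Kx⊆Kq) =
      (λ y Kpy → Kx⊆Kq y (Kp⊆Kx y Kpy)) , (λ y Kqy → Kx⊆Kp y (Kq⊆Kx y Kqy))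

  -- Communities, taken up to extensional equality since 𝒯 must be a Set-valued predicate.
  Community : Subset Carrier → Set
  Community T = ∃ λ p → K S p ≐ T

  regular⇒partition : Regular S → PartitionsIntoTopens S
  regular⇒partition regular =
    Community ,
    (λ { T (p , Kp≐T) → Topen-resp-≐ Kp≐T (K-topen regular p) }) ,
    disjoint ,
    (λ x → K S x , (x , (λ _ Kxy → Kxy) , (λ _ Kxy → Kxy)) , K-self regular x)
    where
    disjoint : ∀ T T' → Community T → Community T' → ¬ (T ≐ T') → ¬ (T ≬ T')
    disjoint T T' (p , Kp⊆T , T⊆Kp) (q , Kq⊆T' , T'⊆Kq) T≉T' (x , Tx , T'x)
      with K-≐-if-≬ regular (x , T⊆Kp x Tx , T'⊆Kq x T'x)
    ... | Kp⊆Kq , Kq⊆Kp =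
      T≉T' ((λ y Ty → Kq⊆T' y (Kp⊆Kq y (T⊆Kp y Ty))) , (λ y T'y → Kp⊆T y (Kq⊆Kp y (T'⊆Kq y T'y))))

  partition⇒regular : PartitionsIntoTopens S → Regular S
  partition⇒regular (𝒯 , topens , _ , cover) =
    regular-if-topens-cover λ x → let (T , 𝒯T , Tx) = cover x in T , topens T 𝒯T , Tx

  regular⇒covered : Regular S → EveryCoveredByTopens S
  regular⇒covered regular X =
    Topen S , (λ _ topenT → topenT) , (λ x _ → K S x , K-topen regular x , K-self regular x)

  covered⇒regular : EveryCoveredByTopens S → Regular S
  covered⇒regular covered = regular-if-topens-cover λ x →
    let (𝒯 , topens , cover) = covered fullSet
        (T , 𝒯T , Tx) = cover x tt
    in T , topens T 𝒯T , Tx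

corollary4p25 : (S : Semitopology) →
    ((Regular S → PartitionsIntoTopens S) × (PartitionsIntoTopens S → Regular S))
    × ((Regular S → EveryCoveredByTopens S) × (EveryCoveredByTopens S → Regular S))
corollary4p25 S =
  (regular⇒partition S , partition⇒regular S) , (regular⇒covered S , covered⇒regular S)
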